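{- Let $n\geq 4$ be an integer and let $M(C_n)$ be the middle graph of the cycle $C_n$. Then $\chi_2(M(C_n))=3$ and $\chi_3(M(C_n))=4$.
   Context: The middle graph $M(G)$ of a graph $G$ has vertex set $V(G)\cup E(G)$, two of its vertices being adjacent iff they are two edges of $G$ sharing an endpoint, or one is a vertex of $G$ and the other is an edge of $G$ incident with it. For a graph $H$, $N_H(v)$ is the neighborhood of $v$, $d(v)=|N_H(v)|$, $c(S)=\{c(u):u\in S\}$. For integers $k>0$, $r>0$, a conditional $(k,r)$-coloring of $H$ is a surjective map $c\colon V(H)\to\{1,\ldots,k\}$ such that $c(u)\neq c(v)$ for every edge $uv$, and $|c(N_H(v))|\geq\min\{d(v),r\}$ for every vertex $v$. $\chi_r(H)$ is the smallest $k$ such that $H$ has a conditional $(k,r)$-coloring. -}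

module Defs where

open import Data.Nat using (ℕ; zero; suc; _+_; _≤_; _<_; _⊓_; _≡ᵇ_)
open import Data.Bool using (Bool; true; false; _∧_; _∨_; not; if_then_else_)
open import Data.Fin using (Fin; toℕ; splitAt; _≟_)
open import Data.Fin.Subset using (Subset; ∣_∣)
open import Data.Vec using (tabulate)
open import Data.List using (allFin)
open import Data.Bool.ListAction using (any)
open import Data.Sum using (_⊎_; inj₁; inj₂)
open import Data.Product using (∃; _×_)
open import Relation.Nullary using (¬_)
open import Relation.Nullary.Decidable using (⌊_⌋)
open import Relation.Binary.PropositionalEquality using (_≡_; _≢_)

record IncGraph : Set where
  field
    nV  : ℕ
    nE  : ℕ
    inc : Fin nV → Fin nE → Bool
open IncGraph public

record Graph : Set where
  field
    N   : ℕ
    adj : Fin N → Fin N → Bool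
open Graph public

-- The cycle C_n: vertices 0..n-1, edge e joins vertex e and vertex e+1 (mod n).
succMod : ℕ → ℕ → ℕ
succMod n i = if (suc i ≡ᵇ n) then 0 else suc i

Cycle : ℕ → IncGraph
Cycle n = record
  { nV = n ; nE = n
  ; inc = λ v e → (toℕ v ≡ᵇ toℕ e) ∨ (toℕ v ≡ᵇ succMod n (toℕ e)) }

-- The middle graph M(G): vertex set V(G) ⊎ E(G), encoded as Fin (nV + nE)
-- (first nV = vertices of G, remaining nE = edges of G).
middleAdj : (G : IncGraph) → Fin (nV G) ⊎ Fin (nE G) → Fin (nV G) ⊎ Fin (nE G) → Bool
middleAdj G (inj₁ _) (inj₁ _) = false
middleAdj G (inj₁ v) (inj₂ e) = inc G v e
middleAdj G (inj₂ e) (inj₁ v) = inc G v e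
middleAdj G (inj₂ e) (inj₂ f) =
  not ⌊ e ≟ f ⌋ ∧ any (λ v → inc G v e ∧ inc G v f) (allFin (nV G))

Middle : IncGraph → Graph
Middle G = record
  { N = nV G + nE G
  ; adj = λ x y → middleAdj G (splitAt (nV G) x) (splitAt (nV G) y) }

nbhd : (H : Graph) → Fin (N H) → Subset (N H)
nbhd H v = tabulate (λ u → adj H v u)

deg : (H : Graph) → Fin (N H) → ℕ
deg H v = ∣ nbhd H v ∣

colourImage : (H : Graph) {k : ℕ} → (Fin (N H) → Fin k) → Fin (N H) → Subset k
colourImage H c v =
  tabulate (λ j → any (λ u → adj H v u ∧ ⌊ c u ≟ j ⌋) (allFin (N H)))

-- Conditional (k,r)-colouring (colours 1..k encoded as Fin k).
record CondColouring (H : Graph) (k r : ℕ) : Set where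
  field
    col        : Fin (N H) → Fin k
    surjective : ∀ (j : Fin k) → ∃ λ u → col u ≡ j
    proper     : ∀ u v → adj H u v ≡ true → col u ≢ col v
    condition  : ∀ v → deg H v ⊓ r ≤ ∣ colourImage H col v ∣

IsCondChromatic : (r : ℕ) → Graph → ℕ → Set
IsCondChromatic r H k =
  1 ≤ k × CondColouring H k r × (∀ k′ → 1 ≤ k′ → k′ < k → ¬ CondColouring H k′ r)

module Submission where

-- In M(C_n) each vertex v of C_n forms a triangle with its two edges e_{v-1} and e_v; these
-- n triangles cover all edges of M(C_n), and every object of M(C_n) lies in one of them. So
-- a colouring in which each triangle is rainbow is proper, and every object sees two colours
-- in its neighbourhood, which is the condition for r = 2. For r = 3 the vertices of C_n have
-- only two neighbours, and each edge e_i must see three colours among v_i, v_{i+1}, e_{i-1},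
-- e_{i+1}. Such colourings with 3 resp. 4 colours exist where the colour of an index depends
-- only on its parity and on whether it is the last index; the local conditions are then a
-- finite check over the four kinds of windows of three consecutive indices. Conversely an
-- edge of C_n has at least three neighbours in M(C_n), which must show r colours all
-- different from its own, so χ_r(M(C_n)) ≥ r + 1.

open import Defs
open import Data.Nat
  using (ℕ; zero; suc; pred; parity; _+_; _≤_; _<_; _⊓_; _≡ᵇ_; z≤n; s≤s; s≤s⁻¹; >-nonZero)
open import Data.Nat.Properties
  using (≤-refl; ≤-trans; ≤-reflexive; ≤-<-trans; <-trans; <-irrefl; <⇒≢; <⇒≱; n<1+n; n≤1+n;
         1+n≢n; +-suc; m≤n⇒m≤1+n; m≤n⇒m<n∨m≡n; suc-pred; ⊓-glb; m⊓n≤m; m⊓n≤n; ≡ᵇ⇒≡; ≡⇒≡ᵇ)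
open import Data.Parity.Base using (Parity; 0ℙ; 1ℙ; _⁻¹)
open import Data.Parity.Properties using (⁻¹-selfInverse; suc-homo-⁻¹)
open import Data.Bool using (Bool; true; false; _∨_)
open import Data.Bool.Properties using (T-≡; T-∧; ∨-zeroʳ)
open import Data.Fin using (Fin; zero; suc; #_; toℕ; fromℕ<; join; splitAt)
open import Data.Fin.Properties
  using (toℕ-fromℕ<; toℕ-injective; toℕ<n; splitAt-join; join-splitAt)
open import Data.Fin.Subset using (Subset; ∣_∣; _∈_; _∉_; _⊆_; _∪_; ⁅_⁆; ⊥)
open import Data.Fin.Subset.Properties
  using (p⊆q⇒∣p∣≤∣q∣; p⊂q⇒∣p∣<∣q∣; x∈p∪q⁺; x∈p∪q⁻; x∈⁅x⁆; x∈⁅y⁆⇒x≡y; ∉⊥; ∈⊤;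
         ∣⁅x⁆∣≡1; ∣⊥∣≡0; ∣⊤∣≡n; x∈p∧x≢y⇒x∈p-y; x∈p⇒∣p-x∣<∣p∣)
open import Data.List using (List; []; _∷_; foldr; length; allFin)
open import Data.List.Membership.Propositional using () renaming (_∈_ to _∈ₗ_)
open import Data.List.Membership.Propositional.Properties using (∈-allFin)
open import Data.List.Relation.Unary.All as All using (All; []; _∷_)
open import Data.List.Relation.Unary.Any as Any using (here; there)
open import Data.List.Relation.Unary.Any.Properties using (any⁺; any⁻)
open import Data.List.Relation.Unary.Unique.Propositional using (Unique; []; _∷_)
open import Data.Vec using (_∷_; [])
open import Data.Vec.Properties using (lookup∘tabulate; lookup⇒[]=; []=⇒lookup)
open import Data.Sum using (_⊎_; inj₁; inj₂; [_,_]′)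
open import Data.Sum.Properties using (inj₁-injective)
open import Data.Product using (_×_; _,_; ∃; proj₁; proj₂)
open import Function using (_∘_; Equivalence)
open import Relation.Nullary.Negation using (contradiction)
open import Relation.Nullary.Decidable
  using (fromWitness; toWitness; fromWitnessFalse; toWitnessFalse)
open import Relation.Binary.PropositionalEquality
  using (_≡_; _≢_; refl; sym; trans; cong; cong₂; subst; ≢-sym; module ≡-Reasoning)

open Equivalence using (to; from)
open ≡-Reasoning

∣p∪q∣≤∣p∣+∣q∣ : ∀ {n} (p q : Subset n) → ∣ p ∪ q ∣ ≤ ∣ p ∣ + ∣ q ∣
∣p∪q∣≤∣p∣+∣q∣ []          []          = z≤n
∣p∪q∣≤∣p∣+∣q∣ (true  ∷ p) (true  ∷ q) =
  s≤s (≤-trans (m≤n⇒m≤1+n (∣p∪q∣≤∣p∣+∣q∣ p q)) (≤-reflexive (sym (+-suc _ _))))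
∣p∪q∣≤∣p∣+∣q∣ (true  ∷ p) (false ∷ q) = s≤s (∣p∪q∣≤∣p∣+∣q∣ p q)
∣p∪q∣≤∣p∣+∣q∣ (false ∷ p) (true  ∷ q) =
  ≤-trans (s≤s (∣p∪q∣≤∣p∣+∣q∣ p q)) (≤-reflexive (sym (+-suc _ _)))
∣p∪q∣≤∣p∣+∣q∣ (false ∷ p) (false ∷ q) = ∣p∪q∣≤∣p∣+∣q∣ p q

x∉p⇒∣p∣<n : ∀ {n} {p : Subset n} {x} → x ∉ p → ∣ p ∣ < n
x∉p⇒∣p∣<n {n} {p} {x} x∉p =
  subst (∣ p ∣ <_) (∣⊤∣≡n n) (p⊂q⇒∣p∣<∣q∣ ((λ _ → ∈⊤) , x , ∈⊤ , x∉p))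

length≤∣p∣ : ∀ {n} {p : Subset n} {xs} → Unique xs → All (_∈ p) xs → length xs ≤ ∣ p ∣
length≤∣p∣ []            []           = z≤n
length≤∣p∣ (x≢xs ∷ xs!) (x∈p ∷ xs⊆p) = ≤-<-trans
  (length≤∣p∣ xs! (All.zipWith (λ (y∈p , x≢y) → x∈p∧x≢y⇒x∈p-y y∈p (≢-sym x≢y)) (xs⊆p , x≢xs)))
  (x∈p⇒∣p-x∣<∣p∣ x∈p)

fromList : ∀ {n} → List (Fin n) → Subset n
fromList = foldr (λ x p → ⁅ x ⁆ ∪ p) ⊥

∣fromList∣≤length : ∀ {n} (xs : List (Fin n)) → ∣ fromList xs ∣ ≤ length xs
∣fromList∣≤length {n} []       = ≤-reflexive (∣⊥∣≡0 n)
∣fromList∣≤length (x ∷ xs) = ≤-trans (∣p∪q∣≤∣p∣+∣q∣ ⁅ x ⁆ (fromList xs))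
  (subst (λ c → c + ∣ fromList xs ∣ ≤ suc (length xs)) (sym (∣⁅x⁆∣≡1 x)) (s≤s (∣fromList∣≤length xs)))

∈fromList⁺ : ∀ {n} {x : Fin n} {xs} → x ∈ₗ xs → x ∈ fromList xs
∈fromList⁺ (here refl)  = x∈p∪q⁺ (inj₁ (x∈⁅x⁆ _))
∈fromList⁺ (there x∈xs) = x∈p∪q⁺ (inj₂ (∈fromList⁺ x∈xs))

fromList⊆ : ∀ {n} {p : Subset n} {xs} → All (_∈ p) xs → fromList xs ⊆ p
fromList⊆ []                           y∈⊥ = contradiction y∈⊥ ∉⊥
fromList⊆ {xs = x ∷ _} (x∈p ∷ xs⊆p) y∈ with x∈p∪q⁻ ⁅ x ⁆ _ y∈
... | inj₁ y∈⁅x⁆ = subst (_∈ _) (sym (x∈⁅y⁆⇒x≡y x y∈⁅x⁆)) x∈p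
... | inj₂ y∈xs  = fromList⊆ xs⊆p y∈xs

module _ (H : Graph) where

  ∈-nbhd⁺ : ∀ {v u} → adj H v u ≡ true → u ∈ nbhd H v
  ∈-nbhd⁺ {v} {u} vu = lookup⇒[]= u _ (trans (lookup∘tabulate (adj H v) u) vu)

  ∈-nbhd⁻ : ∀ {v u} → u ∈ nbhd H v → adj H v u ≡ true
  ∈-nbhd⁻ {v} {u} u∈ = trans (sym (lookup∘tabulate (adj H v) u)) ([]=⇒lookup u∈)

  ∈-colourImage⁺ : ∀ {k} (c : Fin (N H) → Fin k) {v u} → adj H v u ≡ true →
                   c u ∈ colourImage H c v
  ∈-colourImage⁺ c {v} {u} vu = lookup⇒[]= (c u) _ (trans (lookup∘tabulate _ (c u))
    (to T-≡ (any⁺ _ (Any.map (λ { refl → from T-∧ (from T-≡ vu , fromWitness refl) }) (∈-allFin u)))))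

  ∈-colourImage⁻ : ∀ {k} (c : Fin (N H) → Fin k) {v j} → j ∈ colourImage H c v →
                   ∃ λ u → adj H v u ≡ true × c u ≡ j
  ∈-colourImage⁻ c {v} {j} j∈ with Any.satisfied (any⁻ _ (allFin (N H))
    (from T-≡ (trans (sym (lookup∘tabulate _ j)) ([]=⇒lookup j∈))))
  ... | u , vu∧cu≡j with to T-∧ vu∧cu≡j
  ... | vu , cu≡j = u , to T-≡ vu , toWitness cu≡j

  colour∉colourImage : ∀ {k} (c : Fin (N H) → Fin k) →
                       (∀ u v → adj H u v ≡ true → c u ≢ c v) → ∀ v → c v ∉ colourImage H c v
  colour∉colourImage c proper v cv∈ with ∈-colourImage⁻ c cv∈
  ... | u , vu , cu≡cv = proper v u vu (sym cu≡cv)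

  condColouring⇒r<k : ∀ {k r} → CondColouring H k r → ∀ v → r ≤ deg H v → r < k
  condColouring⇒r<k C v r≤deg = ≤-<-trans
    (≤-trans (⊓-glb r≤deg ≤-refl) (condition v))
    (x∉p⇒∣p∣<n (colour∉colourImage col proper v))
    where open CondColouring C

  isCondChromatic-1+r : ∀ {r} v → r ≤ deg H v → CondColouring H (suc r) r →
                        IsCondChromatic r H (suc r)
  isCondChromatic-1+r v r≤deg C =
    s≤s z≤n , C , λ k _ k<1+r C′ → <⇒≱ (condColouring⇒r<k C′ v r≤deg) (s≤s⁻¹ k<1+r)

≡ᵇ-true⇒≡ : ∀ {m n} → (m ≡ᵇ n) ≡ true → m ≡ n
≡ᵇ-true⇒≡ {m} {n} eq = ≡ᵇ⇒≡ m n (from T-≡ eq)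

≡⇒≡ᵇ-true : ∀ {m n} → m ≡ n → (m ≡ᵇ n) ≡ true
≡⇒≡ᵇ-true {m} {n} m≡n = to T-≡ (≡⇒≡ᵇ m n m≡n)

≢⇒≡ᵇ-false : ∀ {m n} → m ≢ n → (m ≡ᵇ n) ≡ false
≢⇒≡ᵇ-false {m} {n} m≢n with m ≡ᵇ n in eq
... | false = refl
... | true  = contradiction (≡ᵇ-true⇒≡ eq) m≢n

predMod : ℕ → ℕ → ℕ
predMod n zero    = pred n
predMod n (suc i) = i

module _ {n : ℕ} where

  succMod-wrap : ∀ {i} → suc i ≡ n → succMod n i ≡ 0
  succMod-wrap i+1≡n rewrite ≡⇒≡ᵇ-true i+1≡n = refl

  succMod-inner : ∀ {i} → suc i < n → succMod n i ≡ suc i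
  succMod-inner i+1<n rewrite ≢⇒≡ᵇ-false (<⇒≢ i+1<n) = refl

  succMod-< : ∀ {i} → i < n → succMod n i < n
  succMod-< i<n with m≤n⇒m<n∨m≡n i<n
  ... | inj₁ i+1<n rewrite succMod-inner i+1<n = i+1<n
  ... | inj₂ i+1≡n rewrite succMod-wrap i+1≡n = ≤-trans (s≤s z≤n) i<n

  predMod-< : ∀ {i} → i < n → predMod n i < n
  predMod-< {zero}  0<n   = ≤-reflexive (suc-pred n {{>-nonZero 0<n}})
  predMod-< {suc i} i+1<n = <-trans (n<1+n i) i+1<n

  succMod-predMod : ∀ {i} → i < n → succMod n (predMod n i) ≡ i
  succMod-predMod {zero}  0<n   = succMod-wrap (suc-pred n {{>-nonZero 0<n}})
  succMod-predMod {suc i} i+1<n = succMod-inner i+1<n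

  predMod-succMod : ∀ {i} → i < n → predMod n (succMod n i) ≡ i
  predMod-succMod i<n with m≤n⇒m<n∨m≡n i<n
  ... | inj₁ i+1<n rewrite succMod-inner i+1<n = refl
  ... | inj₂ i+1≡n rewrite succMod-wrap i+1≡n = sym (cong pred i+1≡n)

  succMod≢ : 2 ≤ n → ∀ i → succMod n i ≢ i
  succMod≢ 2≤n i with suc i ≡ᵇ n in eq
  ... | false = 1+n≢n
  ... | true  = λ { refl → <-irrefl (≡ᵇ-true⇒≡ eq) 2≤n }

module _ {n : ℕ} where

  next prev : Fin n → Fin n
  next e = fromℕ< (succMod-< (toℕ<n e))
  prev v = fromℕ< (predMod-< (toℕ<n v))

  toℕ-next : ∀ e → toℕ (next e) ≡ succMod n (toℕ e)
  toℕ-next e = toℕ-fromℕ< _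

  toℕ-prev : ∀ v → toℕ (prev v) ≡ predMod n (toℕ v)
  toℕ-prev v = toℕ-fromℕ< _

  prev-next : ∀ e → prev (next e) ≡ e
  prev-next e = toℕ-injective (begin
    toℕ (prev (next e))           ≡⟨ toℕ-prev (next e) ⟩
    predMod n (toℕ (next e))      ≡⟨ cong (predMod n) (toℕ-next e) ⟩
    predMod n (succMod n (toℕ e)) ≡⟨ predMod-succMod (toℕ<n e) ⟩
    toℕ e                         ∎)

  next-prev : ∀ v → next (prev v) ≡ v
  next-prev v = toℕ-injective (begin
    toℕ (next (prev v))           ≡⟨ toℕ-next (prev v) ⟩
    succMod n (toℕ (prev v))      ≡⟨ cong (succMod n) (toℕ-prev v) ⟩
    succMod n (predMod n (toℕ v)) ≡⟨ succMod-predMod (toℕ<n v) ⟩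
    toℕ v                         ∎)

  next≢ : 2 ≤ n → ∀ e → next e ≢ e
  next≢ 2≤n e next≡e = succMod≢ 2≤n (toℕ e) (trans (sym (toℕ-next e)) (cong toℕ next≡e))

  prev≢ : 2 ≤ n → ∀ e → e ≢ prev e
  prev≢ 2≤n e e≡prev = next≢ 2≤n (prev e) (trans (next-prev e) e≡prev)

  inc-self : ∀ v → inc (Cycle n) v v ≡ true
  inc-self v = cong (_∨ (toℕ v ≡ᵇ succMod n (toℕ v))) (≡⇒≡ᵇ-true {toℕ v} refl)

  inc-next : ∀ e → inc (Cycle n) (next e) e ≡ true
  inc-next e = trans (cong ((toℕ (next e) ≡ᵇ toℕ e) ∨_) (≡⇒≡ᵇ-true (toℕ-next e))) (∨-zeroʳ _)

  inc-prev : ∀ v → inc (Cycle n) v (prev v) ≡ true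
  inc-prev v = subst (λ w → inc (Cycle n) w (prev v) ≡ true) (next-prev v) (inc-next (prev v))

  inc⇒ : ∀ v e → inc (Cycle n) v e ≡ true → e ≡ v ⊎ e ≡ prev v
  inc⇒ v e v∈e with toℕ v ≡ᵇ toℕ e in eq
  ... | true  = inj₁ (sym (toℕ-injective (≡ᵇ-true⇒≡ eq)))
  ... | false = inj₂ (trans (sym (prev-next e)) (cong prev (sym v≡next)))
    where
    v≡next : v ≡ next e
    v≡next = toℕ-injective (trans (≡ᵇ-true⇒≡ v∈e) (sym (toℕ-next e)))

  edges-adjacent : ∀ v {e e′} → inc (Cycle n) v e ≡ true → inc (Cycle n) v e′ ≡ true → e ≢ e′ →
                   middleAdj (Cycle n) (inj₂ e) (inj₂ e′) ≡ true
  edges-adjacent v v∈e v∈e′ e≢e′ = to T-≡ (from T-∧ (fromWitnessFalse e≢e′ ,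
    any⁺ _ (Any.map (λ { refl → from T-∧ (from T-≡ v∈e , from T-≡ v∈e′) }) (∈-allFin v))))

  edges-adjacent⇒ : ∀ e e′ → middleAdj (Cycle n) (inj₂ e) (inj₂ e′) ≡ true →
                    ∃ λ v → (e ≡ v × e′ ≡ prev v) ⊎ (e ≡ prev v × e′ ≡ v)
  edges-adjacent⇒ e e′ ee′ with to T-∧ (from T-≡ ee′)
  ... | e≢e′ , common with Any.satisfied (any⁻ _ (allFin n) common)
  ... | v , v∈both with to T-∧ v∈both
  ... | v∈e , v∈e′ with inc⇒ v e (to T-≡ v∈e) | inc⇒ v e′ (to T-≡ v∈e′)
  ... | inj₁ refl | inj₁ refl = contradiction refl (toWitnessFalse e≢e′)
  ... | inj₁ e≡v  | inj₂ e′≡  = v , inj₁ (e≡v , e′≡)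
  ... | inj₂ e≡   | inj₁ e′≡v = v , inj₂ (e≡ , e′≡v)
  ... | inj₂ refl | inj₂ refl = contradiction refl (toWitnessFalse e≢e′)

  prev-adjacent : 2 ≤ n → ∀ e → middleAdj (Cycle n) (inj₂ e) (inj₂ (prev e)) ≡ true
  prev-adjacent 2≤n e = edges-adjacent e (inc-self e) (inc-prev e) (prev≢ 2≤n e)

  next-adjacent : 2 ≤ n → ∀ e → middleAdj (Cycle n) (inj₂ e) (inj₂ (next e)) ≡ true
  next-adjacent 2≤n e =
    edges-adjacent (next e) (inc-next e) (inc-self (next e)) (≢-sym (next≢ 2≤n e))

  private
    M : Graph
    M = Middle (Cycle n)

  adj-join : ∀ s t → adj M (join n n s) (join n n t) ≡ middleAdj (Cycle n) s t
  adj-join s t = cong₂ (middleAdj (Cycle n)) (splitAt-join n n s) (splitAt-join n n t)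

  join-≢ : ∀ s t → s ≢ t → join n n s ≢ join n n t
  join-≢ s t s≢t eq = s≢t (begin
    s                      ≡⟨ splitAt-join n n s ⟨
    splitAt n (join n n s) ≡⟨ cong (splitAt n) eq ⟩
    splitAt n (join n n t) ≡⟨ splitAt-join n n t ⟩
    t                      ∎)

  ∀-join : ∀ {p} {P : Fin (N M) → Set p} → (∀ s → P (join n n s)) → ∀ x → P x
  ∀-join {P = P} P-join x = subst P (join-splitAt n n x) (P-join (splitAt n x))

  ∈-nbhd-join : ∀ s t → middleAdj (Cycle n) s t ≡ true → join n n t ∈ nbhd M (join n n s)
  ∈-nbhd-join s t st = ∈-nbhd⁺ M (trans (adj-join s t) st)

  edgesAt : Fin n → List (Fin (N M))
  edgesAt v = join n n (inj₂ v) ∷ join n n (inj₂ (prev v)) ∷ []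

  nbhd-vertex⊆edgesAt : ∀ v → nbhd M (join n n (inj₁ v)) ⊆ fromList (edgesAt v)
  nbhd-vertex⊆edgesAt v {u} u∈ = ∈fromList⁺ (neighbour (splitAt n u) (join-splitAt n n u)
    (subst (λ s → middleAdj (Cycle n) s (splitAt n u) ≡ true) (splitAt-join n n (inj₁ v)) (∈-nbhd⁻ M u∈)))
    where
    neighbour : ∀ t → join n n t ≡ u → middleAdj (Cycle n) (inj₁ v) t ≡ true → u ∈ₗ edgesAt v
    neighbour (inj₂ e) refl v∈e with inc⇒ v e v∈e
    ... | inj₁ refl = here refl
    ... | inj₂ refl = there (here refl)

  deg-vertex≤2 : ∀ v → deg M (join n n (inj₁ v)) ≤ 2
  deg-vertex≤2 v = ≤-trans (p⊆q⇒∣p∣≤∣q∣ (nbhd-vertex⊆edgesAt v)) (∣fromList∣≤length (edgesAt v))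

  3≤deg-edge : 2 ≤ n → ∀ e → 3 ≤ deg M (join n n (inj₂ e))
  3≤deg-edge 2≤n e = length≤∣p∣
    (  (join-≢ (inj₁ e) (inj₁ (next e)) (next≢ 2≤n e ∘ sym ∘ inj₁-injective)
        ∷ join-≢ (inj₁ e) (inj₂ (prev e)) (λ ()) ∷ [])
     ∷ (join-≢ (inj₁ (next e)) (inj₂ (prev e)) (λ ()) ∷ [])
     ∷ [] ∷ [])
    (∈-nbhd-join (inj₂ e) (inj₁ e) (inc-self e)
     ∷ ∈-nbhd-join (inj₂ e) (inj₁ (next e)) (inc-next e)
     ∷ ∈-nbhd-join (inj₂ e) (inj₂ (prev e)) (prev-adjacent 2≤n e) ∷ [])

Rainbow : ∀ {a} {A : Set a} → A → A → A → Set a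
Rainbow x y z = x ≢ y × x ≢ z × y ≢ z

module RainbowColouring {n} (2≤n : 2 ≤ n) {k} (f g : Fin n → Fin k)
                        (rainbow : ∀ v → Rainbow (f v) (g (prev v)) (g v)) where

  private
    M : Graph
    M = Middle (Cycle n)

    f≢g∘prev : ∀ v → f v ≢ g (prev v)
    f≢g∘prev = proj₁ ∘ rainbow

    f≢g : ∀ v → f v ≢ g v
    f≢g = proj₁ ∘ proj₂ ∘ rainbow

    g∘prev≢g : ∀ v → g (prev v) ≢ g v
    g∘prev≢g = proj₂ ∘ proj₂ ∘ rainbow

  colour : Fin n ⊎ Fin n → Fin k
  colour = [ f , g ]′

  col : Fin (N M) → Fin k
  col x = colour (splitAt n x)

  col-join : ∀ s → col (join n n s) ≡ colour s
  col-join s = cong colour (splitAt-join n n s)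

  properᴹ : ∀ s t → middleAdj (Cycle n) s t ≡ true → colour s ≢ colour t
  properᴹ (inj₁ v) (inj₁ w) ()
  properᴹ (inj₁ v) (inj₂ e) v∈e with inc⇒ v e v∈e
  ... | inj₁ refl = f≢g v
  ... | inj₂ refl = f≢g∘prev v
  properᴹ (inj₂ e) (inj₁ v) v∈e = ≢-sym (properᴹ (inj₁ v) (inj₂ e) v∈e)
  properᴹ (inj₂ e) (inj₂ e′) ee′ with edges-adjacent⇒ e e′ ee′
  ... | v , inj₁ (refl , refl) = ≢-sym (g∘prev≢g v)
  ... | v , inj₂ (refl , refl) = g∘prev≢g v

  proper : ∀ x y → adj M x y ≡ true → col x ≢ col y
  proper x y = properᴹ (splitAt n x) (splitAt n y)

  ∈-colourImage-join : ∀ s t → middleAdj (Cycle n) s t ≡ true →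
                       colour t ∈ colourImage M col (join n n s)
  ∈-colourImage-join s t st =
    subst (_∈ _) (col-join t) (∈-colourImage⁺ M col (trans (adj-join s t) st))

  2≤∣colourImage∣ : ∀ x → 2 ≤ ∣ colourImage M col x ∣
  2≤∣colourImage∣ = ∀-join twoColours
    where
    twoColours : ∀ s → 2 ≤ ∣ colourImage M col (join n n s) ∣
    twoColours (inj₁ v) = length≤∣p∣ ((g∘prev≢g v ∷ []) ∷ [] ∷ [])
      (∈-colourImage-join (inj₁ v) (inj₂ (prev v)) (inc-prev v)
       ∷ ∈-colourImage-join (inj₁ v) (inj₂ v) (inc-self v) ∷ [])
    twoColours (inj₂ e) = length≤∣p∣ ((f≢g∘prev e ∷ []) ∷ [] ∷ [])
      (∈-colourImage-join (inj₂ e) (inj₁ e) (inc-self e)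
       ∷ ∈-colourImage-join (inj₂ e) (inj₂ (prev e)) (prev-adjacent 2≤n e) ∷ [])

  surjective : (∀ j → ∃ λ s → colour s ≡ j) → ∀ j → ∃ λ x → col x ≡ j
  surjective onto j with onto j
  ... | s , s↦j = join n n s , trans (col-join s) s↦j

  condColouring₂ : (∀ j → ∃ λ s → colour s ≡ j) → CondColouring M k 2
  condColouring₂ onto = record
    { col        = col
    ; surjective = surjective onto
    ; proper     = proper
    ; condition  = λ x → ≤-trans (m⊓n≤n (deg M x) 2) (2≤∣colourImage∣ x)
    }

  condColouring₃ : (∀ j → ∃ λ s → colour s ≡ j) →
                   (∀ e → 3 ≤ ∣ fromList (f e ∷ f (next e) ∷ g (prev e) ∷ g (next e) ∷ []) ∣) →
                   CondColouring M k 3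
  condColouring₃ onto 3≤around = record
    { col        = col
    ; surjective = surjective onto
    ; proper     = proper
    ; condition  = ∀-join condition
    }
    where
    condition : ∀ s → deg M (join n n s) ⊓ 3 ≤ ∣ colourImage M col (join n n s) ∣
    condition (inj₁ v) = ≤-trans (m⊓n≤m _ 3) (≤-trans (deg-vertex≤2 v) (2≤∣colourImage∣ _))
    condition (inj₂ e) = ≤-trans (m⊓n≤n _ 3) (≤-trans (3≤around e) (p⊆q⇒∣p∣≤∣q∣ (fromList⊆
      (∈-colourImage-join (inj₂ e) (inj₁ e) (inc-self e)
       ∷ ∈-colourImage-join (inj₂ e) (inj₁ (next e)) (inc-next e)
       ∷ ∈-colourImage-join (inj₂ e) (inj₂ (prev e)) (prev-adjacent 2≤n e)
       ∷ ∈-colourImage-join (inj₂ e) (inj₂ (next e)) (next-adjacent 2≤n e) ∷ []))))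

-- The parity of an index of C_n and whether it is the last index n - 1.
Site : Set
Site = Parity × Bool

-- The sites of three consecutive indices i - 1, i, i + 1 (mod n) of C_n, for n ≥ 3.
data Window : Site → Site → Site → Set where
  first      : ∀ p → Window (p , true)  (0ℙ , false)   (1ℙ , false)
  interior   : ∀ p → Window (p , false) (p ⁻¹ , false) (p , false)
  beforeLast : ∀ p → Window (p , false) (p ⁻¹ , false) (p , true)
  last       : ∀ p → Window (p , false) (p ⁻¹ , true)  (0ℙ , false)

parity-suc : ∀ i → parity (suc i) ≡ parity i ⁻¹
parity-suc i = sym (⁻¹-selfInverse (suc-homo-⁻¹ i))

module Windows (m : ℕ) where

  private
    n : ℕ
    n = 3 + m

  site : ℕ → Site
  site i = parity i , (suc i ≡ᵇ n)

  windowℕ : ∀ i → i < n → Window (site (predMod n i)) (site i) (site (succMod n i))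
  -- The last flag of index 2 + m is suc (2 + m) ≡ᵇ n, which normalises to m ≡ᵇ m.
  windowℕ zero    _     rewrite ≡⇒≡ᵇ-true {m} refl = first (parity (2 + m))
  windowℕ (suc j) j+2≤n rewrite ≢⇒≡ᵇ-false (<⇒≢ (s≤s⁻¹ j+2≤n)) | parity-suc j
    with suc (suc j) ≡ᵇ n
  ... | true  = last (parity j)
  ... | false with suc (suc (suc j)) ≡ᵇ n
  ...   | true  = beforeLast (parity j)
  ...   | false = interior (parity j)

  window : ∀ v → Window (site (toℕ (prev v))) (site (toℕ v)) (site (toℕ (next v)))
  window v rewrite toℕ-prev v | toℕ-next v = windowℕ (toℕ v) (toℕ<n v)

edgeColour₂ : Site → Fin 3
edgeColour₂ (_  , true)  = # 2
edgeColour₂ (0ℙ , false) = # 0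
edgeColour₂ (1ℙ , false) = # 1

-- A vertex v gets the colour missing from its edges prev v and v, whose sites are the arguments.
vertexColour₂ : Site → Site → Fin 3
vertexColour₂ (_ , true)  _           = # 1
vertexColour₂ (_ , false) (0ℙ , true) = # 0
vertexColour₂ (_ , false) (1ℙ , true) = # 1
vertexColour₂ (_ , false) (_ , false) = # 2

rainbow₂ : ∀ {x y z} → Window x y z → Rainbow (vertexColour₂ x y) (edgeColour₂ x) (edgeColour₂ y)
rainbow₂ (first _)       = (λ ()) , (λ ()) , (λ ())
rainbow₂ (interior 0ℙ)   = (λ ()) , (λ ()) , (λ ())
rainbow₂ (interior 1ℙ)   = (λ ()) , (λ ()) , (λ ())
rainbow₂ (beforeLast 0ℙ) = (λ ()) , (λ ()) , (λ ())
rainbow₂ (beforeLast 1ℙ) = (λ ()) , (λ ()) , (λ ())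
rainbow₂ (last 0ℙ)       = (λ ()) , (λ ()) , (λ ())
rainbow₂ (last 1ℙ)       = (λ ()) , (λ ()) , (λ ())

vertexColour₃ edgeColour₃ : Site → Fin 4
vertexColour₃ (0ℙ , _) = # 0
vertexColour₃ (1ℙ , _) = # 2
edgeColour₃ (0ℙ , true)  = # 2
edgeColour₃ (0ℙ , false) = # 1
edgeColour₃ (1ℙ , _)     = # 3

rainbow₃ : ∀ {x y z} → Window x y z → Rainbow (vertexColour₃ y) (edgeColour₃ x) (edgeColour₃ y)
rainbow₃ (first 0ℙ)      = (λ ()) , (λ ()) , (λ ())
rainbow₃ (first 1ℙ)      = (λ ()) , (λ ()) , (λ ())
rainbow₃ (interior 0ℙ)   = (λ ()) , (λ ()) , (λ ())
rainbow₃ (interior 1ℙ)   = (λ ()) , (λ ()) , (λ ())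
rainbow₃ (beforeLast 0ℙ) = (λ ()) , (λ ()) , (λ ())
rainbow₃ (beforeLast 1ℙ) = (λ ()) , (λ ()) , (λ ())
rainbow₃ (last 0ℙ)       = (λ ()) , (λ ()) , (λ ())
rainbow₃ (last 1ℙ)       = (λ ()) , (λ ()) , (λ ())

3≤∣around∣₃ : ∀ {x y z} → Window x y z →
              3 ≤ ∣ fromList (vertexColour₃ y ∷ vertexColour₃ z ∷ edgeColour₃ x ∷ edgeColour₃ z ∷ []) ∣
3≤∣around∣₃ (first 0ℙ)      = s≤s (s≤s (s≤s z≤n))
3≤∣around∣₃ (first 1ℙ)      = s≤s (s≤s (s≤s z≤n))
3≤∣around∣₃ (interior 0ℙ)   = s≤s (s≤s (s≤s z≤n))
3≤∣around∣₃ (interior 1ℙ)   = s≤s (s≤s (s≤s z≤n))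
3≤∣around∣₃ (beforeLast 0ℙ) = s≤s (s≤s (s≤s z≤n))
3≤∣around∣₃ (beforeLast 1ℙ) = s≤s (s≤s (s≤s z≤n))
3≤∣around∣₃ (last 0ℙ)       = s≤s (s≤s (s≤s z≤n))
3≤∣around∣₃ (last 1ℙ)       = s≤s (s≤s (s≤s z≤n))

module MiddleCycleColourings (m : ℕ) where

  open Windows m

  private
    n : ℕ
    n = 3 + m

    2≤n : 2 ≤ n
    2≤n = s≤s (s≤s z≤n)

  colouring₂ : CondColouring (Middle (Cycle n)) 3 2
  colouring₂ = condColouring₂ onto
    where
    open RainbowColouring 2≤n (λ v → vertexColour₂ (site (toℕ (prev v))) (site (toℕ v)))
                              (λ e → edgeColour₂ (site (toℕ e))) (rainbow₂ ∘ window)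
    onto : ∀ j → ∃ λ s → colour s ≡ j
    onto zero             = inj₂ zero , refl
    onto (suc zero)       = inj₂ (suc zero) , refl
    onto (suc (suc zero)) = inj₁ (suc zero) , refl

  colouring₃ : CondColouring (Middle (Cycle n)) 4 3
  colouring₃ = condColouring₃ onto (3≤∣around∣₃ ∘ window)
    where
    open RainbowColouring 2≤n (vertexColour₃ ∘ site ∘ toℕ) (edgeColour₃ ∘ site ∘ toℕ)
                              (rainbow₃ ∘ window)
    onto : ∀ j → ∃ λ s → colour s ≡ j
    onto zero                   = inj₁ zero , refl
    onto (suc zero)             = inj₂ zero , refl
    onto (suc (suc zero))       = inj₁ (suc zero) , refl
    onto (suc (suc (suc zero))) = inj₂ (suc zero) , refl

proposition5 : ∀ (n : ℕ) → 4 ≤ n →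
    IsCondChromatic 2 (Middle (Cycle n)) 3 × IsCondChromatic 3 (Middle (Cycle n)) 4
proposition5 (suc (suc (suc (suc m)))) (s≤s (s≤s (s≤s (s≤s _)))) =
    isCondChromatic-1+r M e₀ (≤-trans (n≤1+n 2) 3≤deg-e₀) colouring₂
  , isCondChromatic-1+r M e₀ 3≤deg-e₀ colouring₃
  where
  open MiddleCycleColourings (suc m)

  M : Graph
  M = Middle (Cycle (4 + m))

  e₀ : Fin (N M)
  e₀ = join (4 + m) (4 + m) (inj₂ zero)

  3≤deg-e₀ : 3 ≤ deg M e₀
  3≤deg-e₀ = 3≤deg-edge {4 + m} (s≤s (s≤s z≤n)) zero
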